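{- Let $q\in(0,1)$ have finite binary representation $q=0.b_1\cdots b_m=\sum_{k=1}^m b_k/2^k$ with $b_k\in\{0,1\}$. For $k\in\{0,1,\dots,m\}$ let $z_k=k-\sum_{i=1}^k b_i$ (so $z_0=0$). Let $V=\{v_0,\dots,v_{z_m+1}\}$ and for $k\in L=\{1,\dots,m\}$ define $\eta(k)=(v_{z_{k-1}},v_{z_k})$ if $b_k=0$ and $\eta(k)=(v_{z_{k-1}},v_{z_m+1})$ if $b_k=1$. Let $G=(V,E,\mathcal{K})$ be the undirected graph whose edge collection $E$ consists of $m$ edges $e_1,\dots,e_m$, with $e_k$ having end vertices $\eta(k)$ (parallel edges allowed), and with terminal set $\mathcal{K}=\{v_0,v_{z_m+1}\}$. Let every edge fail independently with probability $1/2$. Then the reliability $r_G(P_{1/2})$, i.e. the probability that $v_0$ and $v_{z_m+1}$ are connected by a path of non-failed edges, equals $q$, and $|V|+|E|=z_m+2+m$.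
   Context: Each edge of $G$ works independently with probability $1/2$; reliability $r_G(P_{1/2})=1-u_G(P_{1/2})$ is the probability that the two terminals lie in the same connected component of the subgraph formed by the working edges. -}

module Defs where

open import Data.Bool using (Bool; true; false; if_then_else_)
open import Data.Nat using (ℕ; zero; suc; _+_; _∸_; _^_)
open import Data.Nat.Properties using (m^n≢0)
open import Data.Integer using (+_)
open import Data.Fin using (Fin; toℕ)
open import Data.List using (List; length; take; upTo; foldr; map; filterᵇ)
open import Data.List.Base using (allFin)
open import Data.List.Membership.Propositional using (_∈_)
open import Data.List.Relation.Unary.Unique.Propositional using (Unique)
open import Data.Vec using (Vec; lookup)
open import Data.Rational using (ℚ; 0ℚ; _/_) renaming (_+_ to _+ℚ_)
open import Data.Product using (Σ; _×_; _,_)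
open import Data.Sum using (_⊎_)
open import Function.Bundles using (_⇔_)
open import Relation.Binary.PropositionalEquality using (_≡_)
open import Relation.Binary.Construct.Closure.ReflexiveTransitive using (Star)

-- The bit string b_1 ... b_m is a list `bits` with m = length bits.
-- Edge / bit indices k : Fin m are 0-based: k corresponds to b_{k+1}, e_{k+1}.

bitℕ : Bool → ℕ
bitℕ true  = 1
bitℕ false = 0

ones : List Bool → ℕ
ones xs = foldr (λ b acc → bitℕ b + acc) 0 xs

z : List Bool → ℕ → ℕ
z bits k = k ∸ ones (take k bits)

qOf : (bits : List Bool) → ℚ
qOf bits = foldr _+ℚ_ 0ℚ
  (map (λ (k : Fin (length bits)) →
          _/_ (+ bitℕ (Data.List.lookup bits k)) (2 ^ suc (toℕ k)) {{m^n≢0 2 (suc (toℕ k))}})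
       (allFin (length bits)))

-- Vertices v_0, …, v_{z_m+1} are represented by the natural numbers 0 … z_m+1.
numV : List Bool → ℕ
numV bits = suc (suc (z bits (length bits)))

vertices : List Bool → List ℕ
vertices bits = upTo (numV bits)

s t : List Bool → ℕ
s bits = 0
t bits = suc (z bits (length bits))

η : (bits : List Bool) → Fin (length bits) → ℕ × ℕ
η bits k = z bits (toℕ k) ,
  (if Data.List.lookup bits k then t bits else z bits (suc (toℕ k)))

edges : (bits : List Bool) → List (Fin (length bits))
edges bits = allFin (length bits)

-- A state of the edges: S k = true iff edge e_{k+1} works.
State : List Bool → Set
State bits = Vec Bool (length bits)

Adj : (bits : List Bool) → State bits → ℕ → ℕ → Set
Adj bits S u v = Σ (Fin (length bits)) λ k →
  lookup S k ≡ true × (η bits k ≡ (u , v) ⊎ η bits k ≡ (v , u))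

TerminalsConnected : (bits : List Bool) → State bits → Set
TerminalsConnected bits S = Star (Adj bits S) (s bits) (t bits)

NumConnected : (bits : List Bool) → ℕ → Set
NumConnected bits N = Σ (List (State bits)) λ L →
  Unique L × ((S : State bits) → (S ∈ L) ⇔ TerminalsConnected bits S) × length L ≡ N

-- each of the 2^m edge states has probability (1/2)^m, so r_G(P_{1/2}) = N / 2^m
ReliabilityHalfIs : (bits : List Bool) → ℚ → Set
ReliabilityHalfIs bits r = Σ ℕ λ N →
  NumConnected bits N × r ≡ _/_ (+ N) (2 ^ length bits) {{m^n≢0 2 (length bits)}}

module Submission where

-- The graph G(b₁ ⋯ bₘ) is built recursively from G(b₂ ⋯ bₘ):
--   * if b₁ = 1, the edge e₁ joins the terminals v₀ and t directly, and the
--     remaining edges form G(b₂ ⋯ bₘ) on the same vertices;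
--   * if b₁ = 0, the edge e₁ joins v₀ to v₁, and the remaining edges form
--     G(b₂ ⋯ bₘ) with every vertex shifted up by one; contracting e₁ undoes
--     the shift.
-- Hence in a state x ∷ S the terminals are connected iff x holds or S connects
-- them in G(b₂ ⋯ bₘ) (when b₁ = 1), resp. iff both hold (when b₁ = 0).
-- Following this recursion we list the connected states (`connectedStates`)
-- and count them: there are value(b) = ∑ bₖ 2^(m-k) of them, the number with
-- binary digits b₁ ⋯ bₘ.  Independently, qOf b = ∑ bₖ/2^k = value(b)/2^m, so
-- the reliability value(b)/2^m equals q.

open import Defs
open import Data.Bool using (Bool; true; false; if_then_else_)
open import Data.Nat using (ℕ; zero; suc; pred; _+_; _*_; _^_; _≤_; z≤n; s≤s; NonZero)
open import Data.Nat.Properties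
  using (+-identityʳ; *-identityˡ; +-suc; +-comm; +-∸-assoc; m≤n⇒m≤1+n; m*n≢0; m^n≢0; ^-distribˡ-+-*)
open import Data.Nat.Tactic.RingSolver using (solve-∀)
open import Data.Integer as ℤ using (ℤ; +_)
open import Data.Integer.Properties using (pos-+; pos-*)
open import Data.Rational using (ℚ; 0ℚ; toℚᵘ) renaming (_+_ to _+ℚ_; _/_ to _/ℚ_)
open import Data.Rational.Properties using (toℚᵘ-injective; toℚᵘ-fromℚᵘ; toℚᵘ-homo-+; /-cong; 0/n≡0)
open import Data.Rational.Unnormalised using (*≡*) renaming (_+_ to _+ᵘ_; _/_ to _/ᵘ_; _≃_ to _≃ᵘ_)
open import Data.Rational.Unnormalised.Properties using (≃-sym; +-cong)
open import Data.Fin using (zero; suc; toℕ)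
open import Data.List using (List; []; _∷_; [_]; length; take; map; _++_; foldr; tabulate; lookup)
open import Data.List.Properties using (length-++; length-map; map-tabulate; tabulate-cong; length-upTo; length-tabulate)
open import Data.List.Membership.Propositional using (_∈_)
open import Data.List.Membership.Propositional.Properties using (∈-map⁺; ∈-map⁻; ∈-++⁺ˡ; ∈-++⁺ʳ; ∈-++⁻)
open import Data.List.Relation.Unary.Any using (Any; here)
open import Data.List.Relation.Unary.Unique.Propositional using (Unique)
import Data.List.Relation.Unary.Unique.Propositional.Properties as Unique
import Data.List.Relation.Unary.All as All
import Data.List.Relation.Unary.AllPairs as AllPairs
open import Data.Vec using (Vec; []; _∷_)
open import Data.Vec.Properties using (∷-injectiveʳ)
open import Data.Product using (_×_; _,_; proj₁; proj₂)
import Data.Product as Product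
open import Data.Sum using (_⊎_; inj₁; inj₂)
open import Data.Empty using (⊥; ⊥-elim)
open import Function using (_∘_; id)
open import Function.Bundles using (_⇔_; mk⇔; module Equivalence)
import Function.Properties.Equivalence as ⇔
open import Relation.Nullary using (¬_)
open import Relation.Binary.Core using (Rel)
open import Relation.Binary.PropositionalEquality using (_≡_; refl; sym; trans; cong; cong₂; subst; module ≡-Reasoning)
open import Relation.Binary.Construct.Closure.ReflexiveTransitive using (Star; ε; _◅_; gmap)
import Relation.Binary.Construct.Closure.ReflexiveTransitive as Star

toℚᵘ-/ : ∀ i n .{{_ : NonZero n}} → toℚᵘ (i /ℚ n) ≃ᵘ (i /ᵘ n)
toℚᵘ-/ i (suc n) = toℚᵘ-fromℚᵘ (i /ᵘ suc n)

-- The cross-multiplication identity behind `fraction-add`, proved in ℕ and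
-- transported to ℤ along the semiring homomorphism +_.
cross-multiplied : ∀ a c d e →
  (+ a ℤ.* + (d * e) ℤ.+ + c ℤ.* + d) ℤ.* + (d * e) ≡ + (a * e + c) ℤ.* + (d * (d * e))
cross-multiplied a c d e = begin
    (+ a ℤ.* + (d * e) ℤ.+ + c ℤ.* + d) ℤ.* + (d * e)
  ≡⟨ cong (ℤ._* + (d * e)) (cong₂ ℤ._+_ (sym (pos-* a (d * e))) (sym (pos-* c d))) ⟩
    (+ (a * (d * e)) ℤ.+ + (c * d)) ℤ.* + (d * e)
  ≡⟨ cong (ℤ._* + (d * e)) (sym (pos-+ (a * (d * e)) (c * d))) ⟩
    + (a * (d * e) + c * d) ℤ.* + (d * e)
  ≡⟨ sym (pos-* (a * (d * e) + c * d) (d * e)) ⟩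
    + ((a * (d * e) + c * d) * (d * e))
  ≡⟨ cong +_ (in-ℕ a c d e) ⟩
    + ((a * e + c) * (d * (d * e)))
  ≡⟨ pos-* (a * e + c) (d * (d * e)) ⟩
    + (a * e + c) ℤ.* + (d * (d * e))
  ∎
  where
  open ≡-Reasoning
  in-ℕ : ∀ a c d e → (a * (d * e) + c * d) * (d * e) ≡ (a * e + c) * (d * (d * e))
  in-ℕ = solve-∀

fraction-add : ∀ a c d e .{{_ : NonZero d}} .{{_ : NonZero e}} →
  (+ a /ℚ d) +ℚ (+ c /ℚ (d * e)) {{m*n≢0 d e}} ≡ (+ (a * e + c) /ℚ (d * e)) {{m*n≢0 d e}}
fraction-add a c d@(suc _) e@(suc _) = toℚᵘ-injective (begin
    toℚᵘ ((+ a /ℚ d) +ℚ (+ c /ℚ (d * e)))     ≈⟨ toℚᵘ-homo-+ (+ a /ℚ d) (+ c /ℚ (d * e)) ⟩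
    toℚᵘ (+ a /ℚ d) +ᵘ toℚᵘ (+ c /ℚ (d * e))  ≈⟨ +-cong (toℚᵘ-/ (+ a) d) (toℚᵘ-/ (+ c) (d * e)) ⟩
    (+ a /ᵘ d) +ᵘ (+ c /ᵘ (d * e))            ≈⟨ *≡* (cross-multiplied a c d e) ⟩
    + (a * e + c) /ᵘ (d * e)                  ≈⟨ ≃-sym (toℚᵘ-/ (+ (a * e + c)) (d * e)) ⟩
    toℚᵘ (+ (a * e + c) /ℚ (d * e))           ∎)
  where open Data.Rational.Unnormalised.Properties.≃-Reasoning

infixl 7 _/2^_
_/2^_ : ℤ → ℕ → ℚ
i /2^ n = (i /ℚ 2 ^ n) {{m^n≢0 2 n}}

dyadic-add : ∀ a c k n → (+ a /2^ k) +ℚ (+ c /2^ (k + n)) ≡ + (a * 2 ^ n + c) /2^ (k + n)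
dyadic-add a c k n = begin
    (+ a /2^ k) +ℚ (+ c /2^ (k + n))
  ≡⟨ cong ((+ a /2^ k) +ℚ_) (/-cong {+ c} refl (^-distribˡ-+-* 2 k n)) ⟩
    (+ a /ℚ 2 ^ k) +ℚ (+ c /ℚ (2 ^ k * 2 ^ n))
  ≡⟨ fraction-add a c (2 ^ k) (2 ^ n) ⟩
    + (a * 2 ^ n + c) /ℚ (2 ^ k * 2 ^ n)
  ≡⟨ /-cong {+ (a * 2 ^ n + c)} refl (sym (^-distribˡ-+-* 2 k n)) ⟩
    + (a * 2 ^ n + c) /2^ (k + n)
  ∎
  where
  open ≡-Reasoning
  instance
    2^k≢0 : NonZero (2 ^ k)
    2^k≢0 = m^n≢0 2 k
    2^n≢0 : NonZero (2 ^ n)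
    2^n≢0 = m^n≢0 2 n
    2^k+n≢0 : NonZero (2 ^ (k + n))
    2^k+n≢0 = m^n≢0 2 (k + n)
    2^k*2^n≢0 : NonZero (2 ^ k * 2 ^ n)
    2^k*2^n≢0 = m*n≢0 (2 ^ k) (2 ^ n)

digitsFrom : ℕ → List Bool → ℚ
digitsFrom j []       = 0ℚ
digitsFrom j (b ∷ bs) = (+ bitℕ b /2^ suc j) +ℚ digitsFrom (suc j) bs

value : List Bool → ℕ
value []       = 0
value (b ∷ bs) = bitℕ b * 2 ^ length bs + value bs

sum-digits : ∀ j bs →
  foldr _+ℚ_ 0ℚ (tabulate (λ k → + bitℕ (lookup bs k) /2^ suc (j + toℕ k))) ≡ digitsFrom j bs
sum-digits j []       = refl
sum-digits j (b ∷ bs) = cong₂ _+ℚ_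
  (cong (λ i → + bitℕ b /2^ suc i) (+-identityʳ j))
  (trans (cong (foldr _+ℚ_ 0ℚ) (tabulate-cong λ k →
            cong (λ i → + bitℕ (lookup bs k) /2^ suc i) (+-suc j (toℕ k))))
         (sum-digits (suc j) bs))

-- qOf sums over allFin m = tabulate id, i.e. it is the case j = 0.
qOf-digits : ∀ bs → qOf bs ≡ digitsFrom 0 bs
qOf-digits bs = trans
  (cong (foldr _+ℚ_ 0ℚ) (map-tabulate id (λ k → + bitℕ (lookup bs k) /2^ suc (toℕ k))))
  (sum-digits 0 bs)

digitsFrom-value : ∀ j bs → digitsFrom j bs ≡ + value bs /2^ (j + length bs)
digitsFrom-value j []       = sym (0/n≡0 (2 ^ (j + 0)) {{m^n≢0 2 (j + 0)}})
digitsFrom-value j (b ∷ bs) = begin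
    (+ bitℕ b /2^ suc j) +ℚ digitsFrom (suc j) bs
  ≡⟨ cong ((+ bitℕ b /2^ suc j) +ℚ_) (digitsFrom-value (suc j) bs) ⟩
    (+ bitℕ b /2^ suc j) +ℚ (+ value bs /2^ (suc j + length bs))
  ≡⟨ dyadic-add (bitℕ b) (value bs) (suc j) (length bs) ⟩
    + value (b ∷ bs) /2^ (suc j + length bs)
  ≡⟨ cong (+ value (b ∷ bs) /2^_) (sym (+-suc j (length bs))) ⟩
    + value (b ∷ bs) /2^ (j + suc (length bs))
  ∎
  where open ≡-Reasoning

qOf-value : ∀ bs → qOf bs ≡ + value bs /2^ length bs
qOf-value bs = trans (qOf-digits bs) (digitsFrom-value 0 bs)

-- A path survives any map f of the vertices under which every step either
-- collapses to a single vertex or becomes a step of the target relation;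
-- this is how paths behave under contraction of edges.
contract-path : ∀ {a b ℓ₁ ℓ₂} {I : Set a} {J : Set b} {T : Rel I ℓ₁} {U : Rel J ℓ₂}
  (f : I → J) → (∀ {u v} → T u v → f u ≡ f v ⊎ U (f u) (f v)) →
  ∀ {u v} → Star T u v → Star U (f u) (f v)
contract-path f step ε = ε
contract-path {U = U} f step {v = w} (r ◅ rs) with step r
... | inj₁ same = subst (λ x → Star U x (f w)) (sym same) (contract-path f step rs)
... | inj₂ r′   = r′ ◅ contract-path f step rs

ones-take-≤ : ∀ k bs → ones (take k bs) ≤ k
ones-take-≤ zero    bs           = z≤n
ones-take-≤ (suc k) []           = z≤n
ones-take-≤ (suc k) (true ∷ bs)  = s≤s (ones-take-≤ k bs)
ones-take-≤ (suc k) (false ∷ bs) = m≤n⇒m≤1+n (ones-take-≤ k bs)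

-- A leading 0 bit shifts every z_k, hence every vertex index, up by one.
-- (A leading 1 bit leaves them unchanged, which holds definitionally.)
z-false : ∀ bs k → z (false ∷ bs) (suc k) ≡ suc (z bs k)
z-false bs k = +-∸-assoc 1 (ones-take-≤ k bs)

t-false : ∀ bs → t (false ∷ bs) ≡ suc (t bs)
t-false bs = cong suc (z-false bs (length bs))

η-false : ∀ bs k → η (false ∷ bs) (suc k) ≡ Product.map suc suc (η bs k)
η-false bs k = cong₂ _,_ (z-false bs (toℕ k)) (second-end (lookup bs k))
  where
  second-end : ∀ b → (if b then t (false ∷ bs) else z (false ∷ bs) (suc (suc (toℕ k))))
                     ≡ suc (if b then t bs else z bs (suc (toℕ k)))
  second-end true  = t-false bs
  second-end false = z-false bs (suc (toℕ k))

adj-true-tail : ∀ {bs S u v} x → Adj bs S u v → Adj (true ∷ bs) (x ∷ S) u v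
adj-true-tail x (k , works , ends) = suc k , works , ends

adj-true-off : ∀ {bs S u v} → Adj (true ∷ bs) (false ∷ S) u v → Adj bs S u v
adj-true-off (suc k , works , ends) = k , works , ends

adj-false-tail : ∀ {bs S u v} x → Adj bs S u v → Adj (false ∷ bs) (x ∷ S) (suc u) (suc v)
adj-false-tail {bs} x (k , works , inj₁ ends) =
  suc k , works , inj₁ (trans (η-false bs k) (cong (Product.map suc suc) ends))
adj-false-tail {bs} x (k , works , inj₂ ends) =
  suc k , works , inj₂ (trans (η-false bs k) (cong (Product.map suc suc) ends))

-- Contracting a working e₁ = v₀v₁ (i.e. applying pred to the vertices) turns
-- every working edge of G(false ∷ bs) into a loop or a working edge of G(bs).
adj-false-contract : ∀ {bs S u v} → Adj (false ∷ bs) (true ∷ S) u v →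
  pred u ≡ pred v ⊎ Adj bs S (pred u) (pred v)
adj-false-contract (zero , _ , inj₁ refl) = inj₁ refl
adj-false-contract (zero , _ , inj₂ refl) = inj₁ refl
adj-false-contract {bs} (suc k , works , inj₁ ends) =
  inj₂ (k , works , inj₁ (cong (Product.map pred pred) (trans (sym (η-false bs k)) ends)))
adj-false-contract {bs} (suc k , works , inj₂ ends) =
  inj₂ (k , works , inj₂ (cong (Product.map pred pred) (trans (sym (η-false bs k)) ends)))

v₀-isolated : ∀ {bs S v} → ¬ Adj (false ∷ bs) (false ∷ S) 0 v
v₀-isolated (zero , () , _)
v₀-isolated {bs} (suc k , _ , inj₁ ends) with () ← cong proj₁ (trans (sym (η-false bs k)) ends)
v₀-isolated {bs} (suc k , _ , inj₂ ends) with () ← cong proj₂ (trans (sym (η-false bs k)) ends)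

disconnected-empty : ¬ TerminalsConnected [] []
disconnected-empty ((() , _) ◅ _)

connected-direct : ∀ bs S → TerminalsConnected (true ∷ bs) (true ∷ S)
connected-direct bs S = (zero , refl , inj₁ refl) ◅ ε

connected-true-off : ∀ bs S → TerminalsConnected (true ∷ bs) (false ∷ S) ⇔ TerminalsConnected bs S
connected-true-off bs S = mk⇔ (Star.map adj-true-off) (Star.map (adj-true-tail false))

connected-false-on : ∀ bs S → TerminalsConnected (false ∷ bs) (true ∷ S) ⇔ TerminalsConnected bs S
connected-false-on bs S = mk⇔ contract extend
  where
  contract : TerminalsConnected (false ∷ bs) (true ∷ S) → TerminalsConnected bs S
  contract path = subst (Star (Adj bs S) 0) (z-false bs (length bs))
    (contract-path pred adj-false-contract path)
  extend : TerminalsConnected bs S → TerminalsConnected (false ∷ bs) (true ∷ S)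
  extend path = (zero , refl , inj₁ refl) ◅
    subst (Star (Adj (false ∷ bs) (true ∷ S)) 1) (sym (t-false bs)) (gmap suc (adj-false-tail true) path)

disconnected-false-off : ∀ bs S → ¬ TerminalsConnected (false ∷ bs) (false ∷ S)
disconnected-false-off bs S (edge ◅ _) = v₀-isolated edge

branch : ∀ {n} → List (Vec Bool n) → List (Vec Bool n) → List (Vec Bool (suc n))
branch A B = map (true ∷_) A ++ map (false ∷_) B

∈-branch : ∀ {n} x {S : Vec Bool n} A B → (x ∷ S) ∈ branch A B ⇔ S ∈ (if x then A else B)
∈-branch true  A B = mk⇔ from (∈-++⁺ˡ ∘ ∈-map⁺ (true ∷_))
  where
  from : _ ∈ branch A B → _ ∈ A
  from p with ∈-++⁻ (map (true ∷_) A) p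
  ... | inj₁ q with ∈-map⁻ (true ∷_) q
  ...   | _ , S∈A , refl = S∈A
  from p | inj₂ q with ∈-map⁻ (false ∷_) q
  ...   | _ , _ , ()
∈-branch false A B = mk⇔ from (∈-++⁺ʳ (map (true ∷_) A) ∘ ∈-map⁺ (false ∷_))
  where
  from : _ ∈ branch A B → _ ∈ B
  from p with ∈-++⁻ (map (true ∷_) A) p
  ... | inj₂ q with ∈-map⁻ (false ∷_) q
  ...   | _ , S∈B , refl = S∈B
  from p | inj₁ q with ∈-map⁻ (true ∷_) q
  ...   | _ , _ , ()

unique-branch : ∀ {n} {A B : List (Vec Bool n)} → Unique A → Unique B → Unique (branch A B)
unique-branch uA uB = Unique.++⁺ (Unique.map⁺ ∷-injectiveʳ uA) (Unique.map⁺ ∷-injectiveʳ uB) disjoint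
  where
  disjoint : ∀ {S} → S ∈ map (true ∷_) _ × S ∈ map (false ∷_) _ → ⊥
  disjoint (p , q) with ∈-map⁻ (true ∷_) p | ∈-map⁻ (false ∷_) q
  ... | _ , _ , refl | _ , _ , ()

length-branch : ∀ {n} (A B : List (Vec Bool n)) → length (branch A B) ≡ length A + length B
length-branch A B = trans (length-++ (map (true ∷_) A))
  (cong₂ _+_ (length-map (true ∷_) A) (length-map (false ∷_) B))

allStates : ∀ n → List (Vec Bool n)
allStates zero    = [ [] ]
allStates (suc n) = branch (allStates n) (allStates n)

∈-allStates : ∀ {n} (S : Vec Bool n) → S ∈ allStates n
∈-allStates []      = here refl
∈-allStates (x ∷ S) = Equivalence.from (∈-branch x _ _) (in-either-half x)
  where
  in-either-half : ∀ x → S ∈ (if x then allStates _ else allStates _)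
  in-either-half true  = ∈-allStates S
  in-either-half false = ∈-allStates S

unique-allStates : ∀ n → Unique (allStates n)
unique-allStates zero    = All.[] AllPairs.∷ AllPairs.[]
unique-allStates (suc n) = unique-branch (unique-allStates n) (unique-allStates n)

length-allStates : ∀ n → length (allStates n) ≡ 2 ^ n
length-allStates zero    = refl
length-allStates (suc n) = trans (length-branch (allStates n) (allStates n))
  (cong₂ _+_ (length-allStates n) (trans (length-allStates n) (sym (+-identityʳ (2 ^ n)))))

connectedStates : (bs : List Bool) → List (State bs)
connectedStates []          = []
connectedStates (true ∷ bs)  = branch (allStates (length bs)) (connectedStates bs)
connectedStates (false ∷ bs) = branch (connectedStates bs) []

∈-connectedStates : ∀ bs S → S ∈ connectedStates bs ⇔ TerminalsConnected bs S
∈-connectedStates []           []          = mk⇔ (λ ()) (⊥-elim ∘ disconnected-empty)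
∈-connectedStates (true ∷ bs)  (true ∷ S)  =
  mk⇔ (λ _ → connected-direct bs S) (λ _ → Equivalence.from (∈-branch true _ _) (∈-allStates S))
∈-connectedStates (true ∷ bs)  (false ∷ S) = ⇔.trans (∈-branch false _ _)
  (⇔.trans (∈-connectedStates bs S) (⇔.sym (connected-true-off bs S)))
∈-connectedStates (false ∷ bs) (true ∷ S)  = ⇔.trans (∈-branch true _ _)
  (⇔.trans (∈-connectedStates bs S) (⇔.sym (connected-false-on bs S)))
∈-connectedStates (false ∷ bs) (false ∷ S) =
  mk⇔ (λ p → ⊥-elim (nothing-in-[] (Equivalence.to (∈-branch false _ _) p)))
      (⊥-elim ∘ disconnected-false-off bs S)
  where
  nothing-in-[] : S ∈ [] → ⊥
  nothing-in-[] ()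

unique-connectedStates : ∀ bs → Unique (connectedStates bs)
unique-connectedStates []           = AllPairs.[]
unique-connectedStates (true ∷ bs)  = unique-branch (unique-allStates (length bs)) (unique-connectedStates bs)
unique-connectedStates (false ∷ bs) = unique-branch (unique-connectedStates bs) AllPairs.[]

length-connectedStates : ∀ bs → length (connectedStates bs) ≡ value bs
length-connectedStates []           = refl
length-connectedStates (true ∷ bs)  = trans (length-branch (allStates (length bs)) (connectedStates bs))
  (cong₂ _+_ (trans (length-allStates (length bs)) (sym (*-identityˡ _))) (length-connectedStates bs))
length-connectedStates (false ∷ bs) = trans (length-branch (connectedStates bs) [])
  (trans (+-identityʳ _) (length-connectedStates bs))

numConnected : ∀ bs → NumConnected bs (value bs)
numConnected bs =
  connectedStates bs , unique-connectedStates bs , ∈-connectedStates bs , length-connectedStates bs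

size : ∀ bs → length (vertices bs) + length (edges bs) ≡ z bs (length bs) + 2 + length bs
size bs = cong₂ _+_ (trans (length-upTo (numV bs)) (+-comm 2 (z bs (length bs)))) (length-tabulate id)

lemma2 : (bits : List Bool) → Any (_≡ true) bits →
    ReliabilityHalfIs bits (qOf bits)
      × length (vertices bits) + length (edges bits) ≡ z bits (length bits) + 2 + length bits
lemma2 bits _ = (value bits , numConnected bits , qOf-value bits) , size bits
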